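{- Let $G$ be a finite noncyclic group and $U\subseteq G$ with $|U|\ge 2$. Then $U$ is an equivalence class of $\equiv$ that is a clique in $\mathcal P_G$ if and only if $U$ is a maximal (with respect to inclusion) homogeneous chain in the poset $L_G$.
   Context: $\mathcal P_G$ is the power graph (vertex set $G$, distinct elements adjacent iff one is a power of the other); $N(x)$ is the set of neighbours of $x$ in $\mathcal P_G$, $N[x]=N(x)\cup\{x\}$; $x\equiv y$ iff $N(x)=N(y)$ or $N[x]=N[y]$ (an equivalence relation). Poset $L_G$: for $x\in G$ let $[x]$ be the set of generators of $\langle x\rangle$; fix an arbitrary linear order on each such set; $x\prec y$ iff ($[x]=[y]$ and $x$ precedes $y$) or $\langle x\rangle\subsetneqq\langle y\rangle$; $L_G=(G,\preceq)$ with $x\preceq y$ iff $x\prec y$ or $x=y$. A chain is a set of pairwise comparable elements; a subset $S$ is homogeneous if for every $y\notin S$ either $x\preceq y$ for all $x\in S$, or $y\preceq x$ for all $x\in S$, or $y$ is incomparable with every $x\in S$. -}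

module Defs where

open import Data.Nat using (ℕ; zero; suc)
open import Data.Fin using (Fin)
open import Data.Product using (Σ; ∃; ∃-syntax; _×_; _,_)
open import Data.Sum using (_⊎_)
open import Data.Empty using (⊥)
open import Relation.Nullary using (¬_)
open import Relation.Binary.PropositionalEquality using (_≡_; _≢_)
open import Algebra.Core using (Op₁; Op₂)
open import Algebra.Structures using (IsGroup)
open import Function.Bundles using (_↔_; _⇔_)

record FiniteGroup : Set₁ where
  field
    Carrier : Set
    _∙_     : Op₂ Carrier
    ε       : Carrier
    _⁻¹     : Op₁ Carrier
    isGroup : IsGroup _≡_ _∙_ ε _⁻¹
    size    : ℕ
    enum    : Fin size ↔ Carrier

module _ (G : FiniteGroup) where
  open FiniteGroup G

  pow : Carrier → ℕ → Carrier
  pow x zero    = ε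
  pow x (suc k) = x ∙ pow x k

  IsPowerOf : Carrier → Carrier → Set
  IsPowerOf y x = ∃[ k ] (y ≡ pow x k)

  IsCyclic : Set
  IsCyclic = ∃[ g ] (∀ x → IsPowerOf x g)

  Adj : Carrier → Carrier → Set
  Adj x y = x ≢ y × (IsPowerOf x y ⊎ IsPowerOf y x)

  -- closed neighbourhood membership: z ∈ N[x]
  AdjC : Carrier → Carrier → Set
  AdjC x z = Adj x z ⊎ z ≡ x

  Equiv : Carrier → Carrier → Set
  Equiv x y = (∀ z → Adj x z ⇔ Adj y z) ⊎ (∀ z → AdjC x z ⇔ AdjC y z)

  Subset : Set₁
  Subset = Carrier → Set

  _⊆_ : Subset → Subset → Set
  U ⊆ V = ∀ x → U x → V x

  IsEquivClass : Subset → Set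
  IsEquivClass U = ∃[ u ] (∀ x → U x ⇔ Equiv u x)

  IsClique : Subset → Set
  IsClique U = ∀ x y → U x → U y → x ≢ y → Adj x y

  AtLeastTwo : Subset → Set
  AtLeastTwo U = ∃[ a ] ∃[ b ] (U a × U b × a ≢ b)

  -- the cyclic subgroup ⟨x⟩ (in a finite group, the natural powers of x)
  Cyc : Carrier → Subset
  Cyc x z = IsPowerOf z x

  CycEq : Carrier → Carrier → Set
  CycEq x y = Cyc x ⊆ Cyc y × Cyc y ⊆ Cyc x

  CycProper : Carrier → Carrier → Set
  CycProper x y = Cyc x ⊆ Cyc y × ¬ (Cyc y ⊆ Cyc x)

  Gens : Carrier → Subset
  Gens x z = CycEq z x

  SameGens : Carrier → Carrier → Set
  SameGens x y = Gens x ⊆ Gens y × Gens y ⊆ Gens x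

  -- A relation R which, restricted to each set [x], is a strict linear order
  -- (this is the "arbitrary linear order fixed on each [x]"; R x y means
  -- x precedes y, and is only consulted when [x] = [y]).
  record IsClassOrder (R : Carrier → Carrier → Set) : Set where
    field
      irrefl : ∀ x → ¬ R x x
      trans  : ∀ x y z → SameGens x y → SameGens y z → R x y → R y z → R x z
      total  : ∀ x y → SameGens x y → x ≢ y → R x y ⊎ R y x

  module _ (R : Carrier → Carrier → Set) where

    _≺_ : Carrier → Carrier → Set
    x ≺ y = (SameGens x y × R x y) ⊎ CycProper x y

    _⪯_ : Carrier → Carrier → Set
    x ⪯ y = x ≺ y ⊎ x ≡ y

    Comparable : Carrier → Carrier → Set
    Comparable x y = x ⪯ y ⊎ y ⪯ x

    IsChain : Subset → Set
    IsChain S = ∀ x y → S x → S y → Comparable x y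

    IsHomogeneous : Subset → Set
    IsHomogeneous S = ∀ y → ¬ S y →
        (∀ x → S x → x ⪯ y)
      ⊎ (∀ x → S x → y ⪯ x)
      ⊎ (∀ x → S x → ¬ Comparable x y)

    IsHomChain : Subset → Set
    IsHomChain S = IsChain S × IsHomogeneous S

    IsMaxHomChain : Subset → Set₁
    IsMaxHomChain S = IsHomChain S × (∀ T → IsHomChain T → S ⊆ T → T ⊆ S)

module Submission where

-- Write x ⋈ y when one of x, y is a power of the other, so that N[x] = {z | x ⋈ z}; x and y are
-- closed twins when N[x] = N[y].  Both sides of the equivalence say that U is a class of closed
-- twins.  For the left side this is graph theory: no two elements of a clique are open twins.
-- For the right side the key fact is convexity: if u ∈ ⟨y⟩ ⊆ ⟨v⟩ with u, v closed twins, then y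
-- is their twin too.  It comes from the arithmetic of a cyclic group ⟨w⟩ of order n: w ^ s is
-- comparable with every power of w only if gcd(s, n) ∈ {1, n} or n is a prime power, and then
-- ⟨w⟩ is a chain; moreover in a noncyclic group an element comparable with every element
-- generates a chain.  Convexity makes a closed-twin class homogeneous in L_G, and conversely
-- homogeneity forces the elements of a homogeneous chain to be closed twins.

open import Defs
open import Level using (0ℓ)
open import Algebra.Bundles using (Group)
open import Algebra.Structures using (IsGroup)
import Algebra.Properties.Group as GroupProperties
import Algebra.Properties.Monoid.Mult as MonoidMultProperties
import Data.Nat as Nat
open import Data.Nat using (ℕ; zero; suc; _+_; _*_; _∸_; _≤_; _<_; NonZero; ≢-nonZero; ≢-nonZero⁻¹; nonTrivial⇒n>1; s<s⁻¹)
open import Data.Nat.Properties hiding (_≟_)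
open import Data.Nat.Divisibility
open import Data.Nat.DivMod using (_%_; _/_; m≡m%n+[m/n]*n; m%n<n)
open import Data.Nat.GCD using (gcd; gcd-GCD; gcd[m,n]∣m; gcd[m,n]∣n; gcd-greatest; module Bézout)
open import Data.Nat.Coprimality using (Coprime; coprime-divisor) renaming (sym to coprime-sym)
open import Data.Nat.Primality using (Prime; prime⇒irreducible; prime⇒nonZero; prime⇒nonTrivial)
open import Data.Nat.Primality.Factorisation using (factorise)
open import Data.Nat.Induction using (<-wellFounded)
open import Data.Nat.ListAction using (product)
open import Data.Nat.Solver using (module +-*-Solver)
open import Data.List using ([]; _∷_)
open import Data.List.Relation.Unary.All using (_∷_)
open import Data.Fin using (Fin; toℕ; fromℕ<)
open import Data.Fin.Properties using (pigeonhole; any?; toℕ-fromℕ<) renaming (_≟_ to _≟ᶠ_)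
open import Data.Product using (∃; ∃₂; ∃-syntax; _×_; _,_; proj₁; proj₂; swap)
import Data.Sum as Sum
open import Data.Sum using (_⊎_; inj₁; inj₂; [_,_]′)
open import Data.Empty using (⊥-elim)
open import Function using (id; _∘_)
open import Function.Bundles using (_⇔_; mk⇔; Injection; module Equivalence)
open import Function.Properties.Inverse using (↔⇒↣; ↔-sym)
open import Function.Properties.Equivalence using () renaming (refl to ⇔-refl; sym to ⇔-sym; trans to ⇔-trans)
open import Induction.WellFounded using (Acc; acc)
open import Relation.Binary.Definitions using (DecidableEquality)
open import Relation.Binary.PropositionalEquality
open import Relation.Nullary using (¬_; Dec; yes; no)
open import Relation.Nullary.Decidable using (via-injection; map′; _⊎-dec_)
open import Relation.Unary using (Decidable)

module DivisorChains where

  open Nat using (_^_)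

  DivisorChain : ℕ → Set
  DivisorChain n = ∀ {d e} → d ∣ n → e ∣ n → d ∣ e ⊎ e ∣ d

  ∃prime∣ : ∀ n → .{{NonZero n}} → n ≢ 1 → ∃[ p ] (Prime p × p ∣ n)
  ∃prime∣ n n≢1 with factorise n
  ... | record { factors = [] ; isFactorisation = eq } = ⊥-elim (n≢1 eq)
  ... | record { factors = p ∷ ps ; isFactorisation = eq ; factorsPrime = prime-p ∷ _ } =
    p , prime-p , subst (p ∣_) (sym eq) (m∣m*n (product ps))

  ^-monoʳ-∣ : ∀ m {i j} → i ≤ j → m ^ i ∣ m ^ j
  ^-monoʳ-∣ m {i} {j} i≤j = divides (m ^ (j ∸ i)) (begin
    m ^ j                 ≡⟨ cong (m ^_) (m+[n∸m]≡n i≤j) ⟨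
    m ^ (i + (j ∸ i))     ≡⟨ ^-distribˡ-+-* m i (j ∸ i) ⟩
    m ^ i * m ^ (j ∸ i)   ≡⟨ *-comm (m ^ i) _ ⟩
    m ^ (j ∸ i) * m ^ i   ∎)
    where open ≡-Reasoning

  module _ {p} (prime-p : Prime p) where

    private instance
      p≢0 = prime⇒nonZero prime-p
      p>1 = prime⇒nonTrivial prime-p

    ∤⇒coprime : ∀ {d} → ¬ p ∣ d → Coprime d p
    ∤⇒coprime p∤d (i∣d , i∣p) with prime⇒irreducible prime-p i∣p
    ... | inj₁ i≡1 = i≡1
    ... | inj₂ refl = ⊥-elim (p∤d i∣d)

    ∤⇒coprime-^ : ∀ {r} → ¬ p ∣ r → ∀ e → Coprime (p ^ e) r
    ∤⇒coprime-^ p∤r zero    (i∣1 , _) = ∣1⇒≡1 i∣1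
    ∤⇒coprime-^ p∤r (suc e) {i} (i∣p^1+e , i∣r) with p ∣? i
    ... | yes p∣i = ⊥-elim (p∤r (∣-trans p∣i i∣r))
    ... | no  p∤i = ∤⇒coprime-^ p∤r e (coprime-divisor (∤⇒coprime p∤i) i∣p^1+e , i∣r)

    split-p-power : ∀ n → .{{NonZero n}} → ∃₂ λ e r → n ≡ p ^ e * r × ¬ p ∣ r
    split-p-power n = go n (<-wellFounded n)
      where
      go : ∀ n → Acc _<_ n → .{{NonZero n}} → ∃₂ λ e r → n ≡ p ^ e * r × ¬ p ∣ r
      go n (acc rec) with p ∣? n
      ... | no p∤n = 0 , n , sym (*-identityˡ n) , p∤n
      ... | yes (divides-refl q) =
        let instance q≢0 = m*n≢0⇒m≢0 q
            e , r , q≡ , p∤r = go q (rec (m<m*n q p (nonTrivial⇒n>1 p)))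
        in suc e , r , trans (cong (_* p) q≡) (trans (*-comm _ p) (sym (*-assoc p (p ^ e) r))) , p∤r

    ∣p^⇒≡p^ : ∀ {d e} → d ∣ p ^ e → ∃[ i ] d ≡ p ^ i
    ∣p^⇒≡p^ {d} {e} d∣p^e with split-p-power d {{d≢0}}
      where
      d≢0 : NonZero d
      d≢0 = ≢-nonZero λ { refl → ≢-nonZero⁻¹ (p ^ e) {{m^n≢0 p e}} (0∣⇒≡0 d∣p^e) }
    ... | i , r , refl , p∤r = i , trans (cong (p ^ i *_) r≡1) (*-identityʳ (p ^ i))
      where
      r≡1 : r ≡ 1
      r≡1 = ∤⇒coprime-^ p∤r e (∣-trans (n∣m*n (p ^ i)) d∣p^e , ∣-refl)

    ^-divisorChain : ∀ e → DivisorChain (p ^ e)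
    ^-divisorChain e d∣ d′∣ with ∣p^⇒≡p^ {e = e} d∣ | ∣p^⇒≡p^ {e = e} d′∣
    ... | i , refl | j , refl with ≤-total i j
    ...   | inj₁ i≤j = inj₁ (^-monoʳ-∣ p i≤j)
    ...   | inj₂ j≤i = inj₂ (^-monoʳ-∣ p j≤i)

  divisorChain⊎coprimeFactors : ∀ n → .{{NonZero n}} →
    DivisorChain n ⊎ ∃₂ λ a b → a * b ≡ n × Coprime a b × a ≢ 1 × b ≢ 1
  divisorChain⊎coprimeFactors n with n Nat.≟ 1
  ... | yes refl = inj₁ λ d∣1 _ → inj₁ (subst (_∣ _) (sym (∣1⇒≡1 d∣1)) (1∣ _))
  ... | no n≢1 with ∃prime∣ n n≢1
  ...   | p , prime-p , p∣n with split-p-power prime-p n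
  ...     | e , r , n≡p^e*r , p∤r with r Nat.≟ 1
  ...       | yes refl = inj₁ (subst DivisorChain (sym (trans n≡p^e*r (*-identityʳ _))) (^-divisorChain prime-p e))
  ...       | no r≢1 = inj₂ (p ^ e , r , sym n≡p^e*r , ∤⇒coprime-^ prime-p p∤r e , p^e≢1 , r≢1)
    where
    p^e≢1 : p ^ e ≢ 1
    p^e≢1 p^e≡1 = p∤r (subst (p ∣_) (trans n≡p^e*r (trans (cong (_* r) p^e≡1) (*-identityˡ r))) p∣n)

  -- If n is not a prime power it is a coprime product a * b, and c must then lie below or above both.
  comparable-divisor : ∀ n → .{{NonZero n}} → ∀ {c} → c ∣ n → (∀ {d} → d ∣ n → d ∣ c ⊎ c ∣ d) →
                       c ≡ 1 ⊎ c ≡ n ⊎ DivisorChain n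
  comparable-divisor n {c} c∣n comparable with divisorChain⊎coprimeFactors n
  ... | inj₁ chain = inj₂ (inj₂ chain)
  ... | inj₂ (a , b , refl , coprime , a≢1 , b≢1) with comparable (m∣m*n b) | comparable (n∣m*n a)
  ...   | inj₂ c∣a | inj₂ c∣b = inj₁ (coprime (c∣a , c∣b))
  ...   | inj₂ c∣a | inj₁ b∣c = ⊥-elim (b≢1 (coprime (∣-trans b∣c c∣a , ∣-refl)))
  ...   | inj₁ a∣c | inj₂ c∣b = ⊥-elim (a≢1 (coprime (∣-refl , ∣-trans a∣c c∣b)))
  ...   | inj₁ (divides-refl k) | inj₁ b∣c =
    inj₂ (inj₁ (∣-antisym c∣n (subst (a * b ∣_) (*-comm a k) (*-monoʳ-∣ a b∣k))))
    where
    b∣k : b ∣ k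
    b∣k = coprime-divisor (coprime-sym coprime) (subst (b ∣_) (*-comm k a) b∣c)

open DivisorChains using (DivisorChain; comparable-divisor)

least-witness : ∀ {P : ℕ → Set} → Decidable P → ∀ {t} → P t → ∃[ n ] (P n × ∀ {k} → k < n → ¬ P k)
least-witness {P} P? {t} Pt = [ id , (λ none → t , Pt , none) ]′ (search t)
  where
  search : ∀ t → (∃[ n ] (P n × ∀ {k} → k < n → ¬ P k)) ⊎ (∀ {k} → k < t → ¬ P k)
  search zero = inj₂ λ ()
  search (suc t) with search t
  ... | inj₁ least = inj₁ least
  ... | inj₂ none with P? t
  ...   | yes Pt = inj₁ (t , Pt , none)
  ...   | no ¬Pt = inj₂ λ k<1+t → [ none , (λ { refl → ¬Pt }) ]′ (m<1+n⇒m<n∨m≡n k<1+t)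

module _ (G : FiniteGroup) where

  open FiniteGroup G renaming (_∙_ to infixl 7 _∙_)
  open IsGroup isGroup using (identityˡ; identityʳ)
  open Equivalence using (to; from)

  group : Group 0ℓ 0ℓ
  group = record { isGroup = isGroup }

  open GroupProperties group using (∙-cancelˡ)
  open MonoidMultProperties (Group.monoid group) using (×-homo-+; ×-assocˡ) renaming (_×_ to _×ᴹ_)

  index : Injection (setoid Carrier) (setoid (Fin size))
  index = ↔⇒↣ (↔-sym enum)

  infix 4 _≟_
  _≟_ : DecidableEquality Carrier
  _≟_ = via-injection index _≟ᶠ_

  infixr 8 _^_
  _^_ : Carrier → ℕ → Carrier
  _^_ = pow G

  ^≡× : ∀ x n → x ^ n ≡ n ×ᴹ x
  ^≡× x zero    = refl
  ^≡× x (suc n) = cong (x ∙_) (^≡× x n)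

  ^-+ : ∀ x m n → x ^ (m + n) ≡ x ^ m ∙ x ^ n
  ^-+ x m n rewrite ^≡× x (m + n) | ^≡× x m | ^≡× x n = ×-homo-+ x m n

  ^-* : ∀ x m n → (x ^ m) ^ n ≡ x ^ (m * n)
  ^-* x m n rewrite ^≡× (x ^ m) n | ^≡× x m | ^≡× x (m * n) | *-comm m n = ×-assocˡ x n m

  ε^ : ∀ n → ε ^ n ≡ ε
  ε^ zero    = refl
  ε^ (suc n) = trans (identityˡ _) (ε^ n)

  ^-+-* : ∀ x {p} i q → x ^ p ≡ ε → x ^ (i + q * p) ≡ x ^ i
  ^-+-* x {p} i q x^p≡ε = begin
    x ^ (i + q * p)       ≡⟨ ^-+ x i (q * p) ⟩
    x ^ i ∙ x ^ (q * p)   ≡⟨ cong (λ k → x ^ i ∙ x ^ k) (*-comm q p) ⟩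
    x ^ i ∙ x ^ (p * q)   ≡⟨ cong (x ^ i ∙_) (^-* x p q) ⟨
    x ^ i ∙ (x ^ p) ^ q   ≡⟨ cong (λ y → x ^ i ∙ y ^ q) x^p≡ε ⟩
    x ^ i ∙ ε ^ q         ≡⟨ cong (x ^ i ∙_) (ε^ q) ⟩
    x ^ i ∙ ε             ≡⟨ identityʳ (x ^ i) ⟩
    x ^ i                 ∎
    where open ≡-Reasoning

  ^≡^+⇒^≡ε : ∀ x m t → x ^ m ≡ x ^ (m + t) → x ^ t ≡ ε
  ^≡^+⇒^≡ε x m t x^m≡x^m+t = ∙-cancelˡ (x ^ m) (x ^ t) ε (begin
    x ^ m ∙ x ^ t   ≡⟨ ^-+ x m t ⟨
    x ^ (m + t)     ≡⟨ x^m≡x^m+t ⟨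
    x ^ m           ≡⟨ identityʳ (x ^ m) ⟨
    x ^ m ∙ ε       ∎)
    where open ≡-Reasoning

  ^-periodic : ∀ x → ∃[ t ] x ^ suc t ≡ ε
  ^-periodic x with pigeonhole (n<1+n size) (λ i → Injection.to index (x ^ toℕ i))
  ... | i , j , i<j , same-image = toℕ j ∸ suc (toℕ i) , ^≡^+⇒^≡ε x (toℕ i) _ (begin
    x ^ toℕ i                               ≡⟨ Injection.injective index same-image ⟩
    x ^ toℕ j                               ≡⟨ cong (x ^_) (trans (+-suc (toℕ i) _) (m+[n∸m]≡n i<j)) ⟨
    x ^ (toℕ i + suc (toℕ j ∸ suc (toℕ i))) ∎)
    where open ≡-Reasoning

  -- Abstract, as unfolding the search during type checking is very expensive.
  abstract
    minimalPeriod : ∀ x → ∃[ n ] (x ^ suc n ≡ ε × ∀ {k} → k < n → x ^ suc k ≢ ε)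
    minimalPeriod x = least-witness (λ k → x ^ suc k ≟ ε) {proj₁ (^-periodic x)} (proj₂ (^-periodic x))

  order : Carrier → ℕ
  order x = suc (proj₁ (minimalPeriod x))

  instance
    order-nonZero : ∀ {x} → NonZero (order x)
    order-nonZero = _

  ^-order : ∀ x → x ^ order x ≡ ε
  ^-order x = proj₁ (proj₂ (minimalPeriod x))

  ^-% : ∀ x k → x ^ k ≡ x ^ (k % order x)
  ^-% x k = trans (cong (x ^_) (m≡m%n+[m/n]*n k (order x))) (^-+-* x (k % order x) (k / order x) (^-order x))

  ^≡ε⇒order∣ : ∀ x {k} → x ^ k ≡ ε → order x ∣ k
  ^≡ε⇒order∣ x {k} x^k≡ε with k % order x in k%n≡r
  ... | zero  = m%n≡0⇒n∣m k (order x) k%n≡r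
  ... | suc r = ⊥-elim (proj₂ (proj₂ (minimalPeriod x)) r<n-1 (begin
    x ^ suc r           ≡⟨ cong (x ^_) k%n≡r ⟨
    x ^ (k % order x)   ≡⟨ ^-% x k ⟨
    x ^ k               ≡⟨ x^k≡ε ⟩
    ε                   ∎))
    where
    open ≡-Reasoning
    r<n-1 : r < proj₁ (minimalPeriod x)
    r<n-1 = s<s⁻¹ (subst (_< order x) k%n≡r (m%n<n k (order x)))

  order∣⇒^≡ε : ∀ x {k} → order x ∣ k → x ^ k ≡ ε
  order∣⇒^≡ε x (divides-refl q) = ^-+-* x 0 q (^-order x)

  ^≡^+⇒order∣ : ∀ x {m t} → x ^ m ≡ x ^ (m + t) → order x ∣ t
  ^≡^+⇒order∣ x {m} {t} x^m≡x^m+t = ^≡ε⇒order∣ x (^≡^+⇒^≡ε x m t x^m≡x^m+t)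

  ∣-of-equal-powers : ∀ x {i m d} → x ^ i ≡ x ^ m → d ∣ order x → d ∣ m → d ∣ i
  ∣-of-equal-powers x {i} {m} {d} x^i≡x^m d∣n d∣m with ≤-total i m
  ... | inj₁ i≤m with m≤n⇒∃[o]m+o≡n i≤m
  ...   | t , refl = ∣m+n∣m⇒∣n (subst (d ∣_) (+-comm i t) d∣m) (∣-trans d∣n (^≡^+⇒order∣ x {i} x^i≡x^m))
  ∣-of-equal-powers x {i} {m} {d} x^i≡x^m d∣n d∣m | inj₂ m≤i with m≤n⇒∃[o]m+o≡n m≤i
  ...   | t , refl = ∣m∣n⇒∣m+n d∣m (∣-trans d∣n (^≡^+⇒order∣ x {m} (sym x^i≡x^m)))

  infix 4 _∈⟨_⟩ _⋈_

  _∈⟨_⟩ : Carrier → Carrier → Set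
  z ∈⟨ x ⟩ = IsPowerOf G z x

  ∈⟨⟩-refl : ∀ x → x ∈⟨ x ⟩
  ∈⟨⟩-refl x = 1 , sym (identityʳ x)

  ∈⟨⟩-trans : ∀ {x y z} → x ∈⟨ y ⟩ → y ∈⟨ z ⟩ → x ∈⟨ z ⟩
  ∈⟨⟩-trans {z = z} (k , refl) (j , refl) = j * k , ^-* z j k

  ε∈⟨⟩ : ∀ x → ε ∈⟨ x ⟩
  ε∈⟨⟩ x = 0 , refl

  ^∈⟨⟩ : ∀ x k → x ^ k ∈⟨ x ⟩
  ^∈⟨⟩ x k = k , refl

  ⊆-trans : ∀ {U V W} → _⊆_ G U V → _⊆_ G V W → _⊆_ G U W
  ⊆-trans U⊆V V⊆W x = V⊆W x ∘ U⊆V x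

  infix 4 _≐_
  _≐_ : Subset G → Subset G → Set
  U ≐ V = _⊆_ G U V × _⊆_ G V U

  ∈⟨⟩⇒⊆ : ∀ {x y} → x ∈⟨ y ⟩ → _⊆_ G (Cyc G x) (Cyc G y)
  ∈⟨⟩⇒⊆ x∈⟨y⟩ z z∈⟨x⟩ = ∈⟨⟩-trans z∈⟨x⟩ x∈⟨y⟩

  cycEq-refl : ∀ x → CycEq G x x
  cycEq-refl x = (λ _ z∈⟨x⟩ → z∈⟨x⟩) , (λ _ z∈⟨x⟩ → z∈⟨x⟩)

  ⊆⇒∈⟨⟩ : ∀ {x y} → _⊆_ G (Cyc G x) (Cyc G y) → x ∈⟨ y ⟩
  ⊆⇒∈⟨⟩ {x} ⟨x⟩⊆⟨y⟩ = ⟨x⟩⊆⟨y⟩ x (∈⟨⟩-refl x)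

  ∈⟨⟩-dec : ∀ z x → Dec (z ∈⟨ x ⟩)
  ∈⟨⟩-dec z x = map′ (λ (k , z≡x^k) → toℕ k , z≡x^k) reduce (any? λ k → z ≟ x ^ toℕ k)
    where
    reduce : z ∈⟨ x ⟩ → ∃ λ (k : Fin (order x)) → z ≡ x ^ toℕ k
    reduce (k , z≡x^k) = fromℕ< (m%n<n k (order x))
                       , trans z≡x^k (trans (^-% x k) (cong (x ^_) (sym (toℕ-fromℕ< (m%n<n k (order x))))))

  ^∈⟨^⟩⇒gcd∣ : ∀ x i j → x ^ i ∈⟨ x ^ j ⟩ → gcd j (order x) ∣ i
  ^∈⟨^⟩⇒gcd∣ x i j (k , x^i≡[x^j]^k) =
    ∣-of-equal-powers x (trans x^i≡[x^j]^k (^-* x j k)) (gcd[m,n]∣n j (order x))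
      (∣-trans (gcd[m,n]∣m j (order x)) (m∣m*n k))

  ^gcd∈⟨^⟩ : ∀ x j → x ^ gcd j (order x) ∈⟨ x ^ j ⟩
  ^gcd∈⟨^⟩ x j with Bézout.identity (gcd-GCD j (order x))
  ... | Bézout.+- a b g+bn≡aj = a , (begin
    x ^ g             ≡⟨ ^-+-* x g b (^-order x) ⟨
    x ^ (g + b * n)   ≡⟨ cong (x ^_) (trans g+bn≡aj (*-comm a j)) ⟩
    x ^ (j * a)       ≡⟨ ^-* x j a ⟨
    (x ^ j) ^ a       ∎)
    where
    open ≡-Reasoning
    n = order x
    g = gcd j n
  ... | Bézout.-+ a b g+aj≡bn = a * m , (begin
    x ^ g                     ≡⟨ ^-+-* x g (a * j) (^-order x) ⟨
    x ^ (g + a * j * n)       ≡⟨ cong (x ^_) (+-*-Solver.solve 4 (λ g a j m → g :+ a :* j :* (con 1 :+ m) := g :+ a :* j :+ j :* (a :* m)) refl g a j m) ⟩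
    x ^ (g + a * j + j * (a * m))  ≡⟨ cong (λ k → x ^ (k + j * (a * m))) g+aj≡bn ⟩
    x ^ (b * n + j * (a * m)) ≡⟨ cong (x ^_) (+-comm (b * n) _) ⟩
    x ^ (j * (a * m) + b * n) ≡⟨ ^-+-* x (j * (a * m)) b (^-order x) ⟩
    x ^ (j * (a * m))         ≡⟨ ^-* x j (a * m) ⟨
    (x ^ j) ^ (a * m)         ∎)
    where
    open ≡-Reasoning
    open +-*-Solver using (_:+_; _:*_; con; _:=_)
    m = proj₁ (minimalPeriod x)
    n = order x
    g = gcd j n

  gcd∣⇒^∈⟨^⟩ : ∀ x i j → gcd j (order x) ∣ i → x ^ i ∈⟨ x ^ j ⟩
  gcd∣⇒^∈⟨^⟩ x .(q * gcd j (order x)) j (divides-refl q) =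
    ∈⟨⟩-trans (q , trans (cong (x ^_) (*-comm q g)) (sym (^-* x g q))) (^gcd∈⟨^⟩ x j)
    where g = gcd j (order x)

  gcd∣gcd⇒^∈⟨^⟩ : ∀ x i j → gcd j (order x) ∣ gcd i (order x) → x ^ i ∈⟨ x ^ j ⟩
  gcd∣gcd⇒^∈⟨^⟩ x i j gcd∣gcd = gcd∣⇒^∈⟨^⟩ x i j (∣-trans gcd∣gcd (gcd[m,n]∣m i (order x)))

  _⋈_ : Carrier → Carrier → Set
  x ⋈ y = x ∈⟨ y ⟩ ⊎ y ∈⟨ x ⟩

  ⋈-refl : ∀ x → x ⋈ x
  ⋈-refl x = inj₁ (∈⟨⟩-refl x)

  ⋈-dec : ∀ x y → Dec (x ⋈ y)
  ⋈-dec x y = ∈⟨⟩-dec x y ⊎-dec ∈⟨⟩-dec y x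

  PowerChain : Carrier → Set
  PowerChain w = ∀ {y z} → y ∈⟨ w ⟩ → z ∈⟨ w ⟩ → y ⋈ z

  powerChain-∈⟨⟩ : ∀ {v w} → PowerChain w → v ∈⟨ w ⟩ → PowerChain v
  powerChain-∈⟨⟩ chain v∈⟨w⟩ y∈⟨v⟩ z∈⟨v⟩ = chain (∈⟨⟩-trans y∈⟨v⟩ v∈⟨w⟩) (∈⟨⟩-trans z∈⟨v⟩ v∈⟨w⟩)

  powerChain-ε : PowerChain ε
  powerChain-ε (i , refl) (j , refl) rewrite ε^ i | ε^ j = ⋈-refl ε

  -- gcd(s, n) is comparable with every divisor of n = order w, so it is 1, n, or n is a prime power.
  comparable-with-all-powers : ∀ {u w} → u ∈⟨ w ⟩ → (∀ j → u ⋈ w ^ j) → w ∈⟨ u ⟩ ⊎ u ≡ ε ⊎ PowerChain w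
  comparable-with-all-powers {w = w} (s , refl) u⋈w^ with comparable-divisor n (gcd[m,n]∣n s n) gcd-comparable
    where
    n = order w
    gcd-comparable : ∀ {d} → d ∣ n → d ∣ gcd s n ⊎ gcd s n ∣ d
    gcd-comparable {d} d∣n with u⋈w^ d
    ... | inj₁ w^s∈⟨w^d⟩ = inj₁ (gcd-greatest (∣-trans (gcd-greatest ∣-refl d∣n) (^∈⟨^⟩⇒gcd∣ w s d w^s∈⟨w^d⟩)) d∣n)
    ... | inj₂ w^d∈⟨w^s⟩ = inj₂ (^∈⟨^⟩⇒gcd∣ w d s w^d∈⟨w^s⟩)
  ... | inj₁ gcd≡1 = inj₁ (subst (_∈⟨ w ^ s ⟩) (identityʳ w) (gcd∣⇒^∈⟨^⟩ w 1 s (subst (_∣ 1) (sym gcd≡1) ∣-refl)))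
  ... | inj₂ (inj₁ gcd≡n) = inj₂ (inj₁ (order∣⇒^≡ε w (subst (_∣ s) gcd≡n (gcd[m,n]∣m s (order w)))))
  ... | inj₂ (inj₂ chain) = inj₂ (inj₂ λ where
    (i , refl) (j , refl) → Sum.map (gcd∣gcd⇒^∈⟨^⟩ w i j) (gcd∣gcd⇒^∈⟨^⟩ w j i)
                              (chain (gcd[m,n]∣n j (order w)) (gcd[m,n]∣n i (order w))))

  ClosedTwins : Carrier → Carrier → Set
  ClosedTwins x y = ∀ z → x ⋈ z ⇔ y ⋈ z

  closedTwins-refl : ∀ {x} → ClosedTwins x x
  closedTwins-refl z = ⇔-refl

  closedTwins-sym : ∀ {x y} → ClosedTwins x y → ClosedTwins y x
  closedTwins-sym x≈y z = ⇔-sym (x≈y z)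

  closedTwins-trans : ∀ {x y w} → ClosedTwins x y → ClosedTwins y w → ClosedTwins x w
  closedTwins-trans x≈y y≈w z = ⇔-trans (x≈y z) (y≈w z)

  closedTwins⇒⋈ : ∀ {x y} → ClosedTwins x y → x ⋈ y
  closedTwins⇒⋈ {y = y} x≈y = from (x≈y y) (⋈-refl y)

  module _ (noncyclic : ¬ IsCyclic G) where

    comparable-with-all⇒powerChain : ∀ {v} → (∀ z → v ⋈ z) → PowerChain v
    comparable-with-all⇒powerChain {v} v⋈ {y} {z} y∈⟨v⟩ z∈⟨v⟩ with ⋈-dec y z
    ... | yes y⋈z = y⋈z
    ... | no  y⋈̸z = ⊥-elim (noncyclic (v , generates))
      where
      generates : ∀ x → x ∈⟨ v ⟩
      generates x with v⋈ x
      ... | inj₂ x∈⟨v⟩ = x∈⟨v⟩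
      ... | inj₁ v∈⟨x⟩ with comparable-with-all-powers v∈⟨x⟩ (λ j → v⋈ (x ^ j))
      ...   | inj₁ x∈⟨v⟩ = x∈⟨v⟩
      ...   | inj₂ (inj₁ v≡ε) = ⊥-elim (y⋈̸z (subst PowerChain (sym v≡ε) powerChain-ε y∈⟨v⟩ z∈⟨v⟩))
      ...   | inj₂ (inj₂ chain) = ⊥-elim (y⋈̸z (powerChain-∈⟨⟩ chain v∈⟨x⟩ y∈⟨v⟩ z∈⟨v⟩))

    between-twins⋈powers : ∀ {u v y z} → ClosedTwins u v → u ∈⟨ y ⟩ → y ∈⟨ v ⟩ → z ∈⟨ v ⟩ → y ⋈ z
    between-twins⋈powers {v = v} u≈v u∈⟨y⟩ y∈⟨v⟩ z∈⟨v⟩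
      with comparable-with-all-powers (∈⟨⟩-trans u∈⟨y⟩ y∈⟨v⟩) (λ j → from (u≈v (v ^ j)) (inj₂ (^∈⟨⟩ v j)))
    ... | inj₁ v∈⟨u⟩ = inj₂ (∈⟨⟩-trans z∈⟨v⟩ (∈⟨⟩-trans v∈⟨u⟩ u∈⟨y⟩))
    ... | inj₂ (inj₁ refl) = comparable-with-all⇒powerChain (λ x → to (u≈v x) (inj₁ (ε∈⟨⟩ x))) y∈⟨v⟩ z∈⟨v⟩
    ... | inj₂ (inj₂ chain) = chain y∈⟨v⟩ z∈⟨v⟩

    closedTwins-convex : ∀ {u v y} → ClosedTwins u v → u ∈⟨ y ⟩ → y ∈⟨ v ⟩ → ClosedTwins u y
    closedTwins-convex u≈v u∈⟨y⟩ y∈⟨v⟩ z = mk⇔ forward backward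
      where
      forward : _ ⋈ z → _ ⋈ z
      forward (inj₂ z∈⟨u⟩) = inj₂ (∈⟨⟩-trans z∈⟨u⟩ u∈⟨y⟩)
      forward (inj₁ u∈⟨z⟩) with to (u≈v z) (inj₁ u∈⟨z⟩)
      ... | inj₁ v∈⟨z⟩ = inj₁ (∈⟨⟩-trans y∈⟨v⟩ v∈⟨z⟩)
      ... | inj₂ z∈⟨v⟩ = between-twins⋈powers u≈v u∈⟨y⟩ y∈⟨v⟩ z∈⟨v⟩
      backward : _ ⋈ z → _ ⋈ z
      backward (inj₁ y∈⟨z⟩) = inj₁ (∈⟨⟩-trans u∈⟨y⟩ y∈⟨z⟩)
      backward (inj₂ z∈⟨y⟩) = from (u≈v z) (inj₂ (∈⟨⟩-trans z∈⟨y⟩ y∈⟨v⟩))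

  ⋈⇔AdjC : ∀ {x z} → x ⋈ z ⇔ AdjC G x z
  ⋈⇔AdjC {x} {z} = mk⇔ to′ from′
    where
    to′ : x ⋈ z → AdjC G x z
    to′ x⋈z with z ≟ x
    ... | yes z≡x = inj₂ z≡x
    ... | no  z≢x = inj₁ ((λ x≡z → z≢x (sym x≡z)) , x⋈z)
    from′ : AdjC G x z → x ⋈ z
    from′ (inj₁ (_ , x⋈z)) = x⋈z
    from′ (inj₂ refl) = ⋈-refl x

  closedTwins⇔sameClosedNbhd : ∀ {x y} → ClosedTwins x y ⇔ (∀ z → AdjC G x z ⇔ AdjC G y z)
  closedTwins⇔sameClosedNbhd = mk⇔
    (λ x≈y z → ⇔-trans (⇔-sym ⋈⇔AdjC) (⇔-trans (x≈y z) ⋈⇔AdjC))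
    (λ same z → ⇔-trans ⋈⇔AdjC (⇔-trans (same z) (⇔-sym ⋈⇔AdjC)))

  equivClass∧clique⇒≐closedTwins : ∀ {U a} → U a → IsEquivClass G U → IsClique G U → U ≐ ClosedTwins a
  equivClass∧clique⇒≐closedTwins {U} Ua (u , U⇔u≡) clique =
    (λ x Ux → closedTwins-trans (closedTwins-sym (twin-of-u Ua)) (twin-of-u Ux)) ,
    (λ x a≈x → from (U⇔u≡ x) (inj₂ (to closedTwins⇔sameClosedNbhd (closedTwins-trans (twin-of-u Ua) a≈x))))
    where
    Uu : U u
    Uu = from (U⇔u≡ u) (inj₂ λ z → ⇔-refl)
    -- N(u) = N(x) is impossible for adjacent x ≠ u, as x ∈ N(u) ∖ N(x).
    twin-of-u : ∀ {x} → U x → ClosedTwins u x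
    twin-of-u {x} Ux with x ≟ u
    ... | yes refl = closedTwins-refl
    ... | no  x≢u with to (U⇔u≡ x) Ux
    ...   | inj₂ same = from closedTwins⇔sameClosedNbhd same
    ...   | inj₁ same = ⊥-elim (proj₁ (to (same x) (clique u x Uu Ux (λ u≡x → x≢u (sym u≡x)))) refl)

  ≐closedTwins⇒clique : ∀ {U a} → U ≐ ClosedTwins a → IsClique G U
  ≐closedTwins⇒clique (U⊆twins , _) x y Ux Uy x≢y =
    x≢y , closedTwins⇒⋈ (closedTwins-trans (closedTwins-sym (U⊆twins x Ux)) (U⊆twins y Uy))

  -- In the case N(a) = N(x) with x ≠ a, the element b ∈ N(a) = N(x) makes x comparable with b,
  -- hence with its closed twin a, which puts x ∈ N(a) ∖ N(x).
  ≐closedTwins⇒equivClass : ∀ {U a b} → U b → a ≢ b → U ≐ ClosedTwins a → IsEquivClass G U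
  ≐closedTwins⇒equivClass {U} {a} {b} Ub a≢b U≐twins@(U⊆twins , twins⊆U) =
    a , λ x → mk⇔ (inj₂ ∘ to closedTwins⇔sameClosedNbhd ∘ U⊆twins x) (equiv⇒U x)
    where
    equiv⇒U : ∀ x → Equiv G a x → U x
    equiv⇒U x (inj₂ same) = twins⊆U x (from closedTwins⇔sameClosedNbhd same)
    equiv⇒U x (inj₁ same) with x ≟ a
    ... | yes refl = twins⊆U a closedTwins-refl
    ... | no  x≢a = ⊥-elim (proj₁ (to (same x) ((λ a≡x → x≢a (sym a≡x)) , a⋈x)) refl)
      where
      x⋈b : x ⋈ b
      x⋈b = proj₂ (to (same b) (≐closedTwins⇒clique U≐twins a b (twins⊆U a closedTwins-refl) Ub a≢b))
      a⋈x : a ⋈ x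
      a⋈x = from (U⊆twins b Ub x) (Sum.swap x⋈b)

  module _ (R : Carrier → Carrier → Set) (classOrder : IsClassOrder G R) where

    open IsClassOrder classOrder using (total)

    ⪯⇒∈⟨⟩ : ∀ {x y} → _⪯_ G R x y → x ∈⟨ y ⟩
    ⪯⇒∈⟨⟩ {x} (inj₁ (inj₁ ((gens-x⊆gens-y , _) , _))) = ⊆⇒∈⟨⟩ (proj₁ (gens-x⊆gens-y x (cycEq-refl x)))
    ⪯⇒∈⟨⟩ (inj₁ (inj₂ (⟨x⟩⊆⟨y⟩ , _))) = ⊆⇒∈⟨⟩ ⟨x⟩⊆⟨y⟩
    ⪯⇒∈⟨⟩ (inj₂ refl) = ∈⟨⟩-refl _

    comparable⇒⋈ : ∀ {x y} → Comparable G R x y → x ⋈ y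
    comparable⇒⋈ = Sum.map ⪯⇒∈⟨⟩ ⪯⇒∈⟨⟩

    ⋈∧∉⇒⪯ : ∀ {x y} → x ⋈ y → ¬ y ∈⟨ x ⟩ → _⪯_ G R x y
    ⋈∧∉⇒⪯ (inj₁ x∈⟨y⟩) y∉⟨x⟩ = inj₁ (inj₂ (∈⟨⟩⇒⊆ x∈⟨y⟩ , y∉⟨x⟩ ∘ ⊆⇒∈⟨⟩))
    ⋈∧∉⇒⪯ (inj₂ y∈⟨x⟩) y∉⟨x⟩ = ⊥-elim (y∉⟨x⟩ y∈⟨x⟩)

    cycEq⇒sameGens : ∀ {x y} → CycEq G x y → SameGens G x y
    cycEq⇒sameGens (⟨x⟩⊆⟨y⟩ , ⟨y⟩⊆⟨x⟩) =
        (λ z (⟨z⟩⊆⟨x⟩ , ⟨x⟩⊆⟨z⟩) → ⊆-trans ⟨z⟩⊆⟨x⟩ ⟨x⟩⊆⟨y⟩ , ⊆-trans ⟨y⟩⊆⟨x⟩ ⟨x⟩⊆⟨z⟩)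
      , (λ z (⟨z⟩⊆⟨y⟩ , ⟨y⟩⊆⟨z⟩) → ⊆-trans ⟨z⟩⊆⟨y⟩ ⟨y⟩⊆⟨x⟩ , ⊆-trans ⟨x⟩⊆⟨y⟩ ⟨y⟩⊆⟨z⟩)

    ⋈⇒comparable : ∀ {x y} → x ⋈ y → Comparable G R x y
    ⋈⇒comparable {x} {y} x⋈y with ∈⟨⟩-dec y x | ∈⟨⟩-dec x y
    ... | no y∉⟨x⟩ | _ = inj₁ (⋈∧∉⇒⪯ x⋈y y∉⟨x⟩)
    ... | yes _ | no x∉⟨y⟩ = inj₂ (⋈∧∉⇒⪯ (Sum.swap x⋈y) x∉⟨y⟩)
    ... | yes y∈⟨x⟩ | yes x∈⟨y⟩ with x ≟ y
    ...   | yes x≡y = inj₁ (inj₂ x≡y)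
    ...   | no  x≢y = Sum.map (λ r → inj₁ (inj₁ (sameGens , r))) (λ r → inj₁ (inj₁ (swap sameGens , r)))
                              (total x y sameGens x≢y)
      where
      sameGens : SameGens G x y
      sameGens = cycEq⇒sameGens (∈⟨⟩⇒⊆ x∈⟨y⟩ , ∈⟨⟩⇒⊆ y∈⟨x⟩)

    homChain-⋈-transfer : ∀ {S p q w} → IsHomChain G R S → S p → S q → p ⋈ w → q ⋈ w
    homChain-⋈-transfer {S} {p} {q} {w} (chain , homogeneous) Sp Sq p⋈w with ⋈-dec q w
    ... | yes q⋈w = q⋈w
    ... | no  q⋈̸w with homogeneous w (λ Sw → q⋈̸w (comparable⇒⋈ (chain q w Sq Sw)))
    ...   | inj₁ S⪯w = ⊥-elim (q⋈̸w (inj₁ (⪯⇒∈⟨⟩ (S⪯w q Sq))))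
    ...   | inj₂ (inj₁ w⪯S) = ⊥-elim (q⋈̸w (inj₂ (⪯⇒∈⟨⟩ (w⪯S q Sq))))
    ...   | inj₂ (inj₂ incomparable) = ⊥-elim (incomparable p Sp (⋈⇒comparable p⋈w))

    homChain⊆closedTwins : ∀ {S a} → IsHomChain G R S → S a → _⊆_ G S (ClosedTwins a)
    homChain⊆closedTwins homChain Sa x Sx z =
      mk⇔ (homChain-⋈-transfer homChain Sa Sx) (homChain-⋈-transfer homChain Sx Sa)

    closedTwins-isChain : ∀ a → IsChain G R (ClosedTwins a)
    closedTwins-isChain a x y a≈x a≈y = ⋈⇒comparable (closedTwins⇒⋈ (closedTwins-trans (closedTwins-sym a≈x) a≈y))

    isHomChain-≐ : ∀ {U V} → U ≐ V → IsHomChain G R V → IsHomChain G R U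
    isHomChain-≐ {U} {V} (U⊆V , V⊆U) (chain , homogeneous) =
        (λ x y Ux Uy → chain x y (U⊆V x Ux) (U⊆V y Uy))
      , (λ y y∉U → Sum.map restrict (Sum.map restrict restrict) (homogeneous y (y∉U ∘ V⊆U y)))
      where
      restrict : ∀ {P : Carrier → Set} → (∀ x → V x → P x) → ∀ x → U x → P x
      restrict P-on-V x Ux = P-on-V x (U⊆V x Ux)

    module _ (noncyclic : ¬ IsCyclic G) where

      -- If a ∈ ⟨y⟩, then y ∈ ⟨x⟩ for a twin x of a would make y a twin by convexity; dually if y ∈ ⟨a⟩.
      closedTwins-isHomogeneous : ∀ a → IsHomogeneous G R (ClosedTwins a)
      closedTwins-isHomogeneous a y a≉y with ⋈-dec a y
      ... | no a⋈̸y = inj₂ (inj₂ λ x a≈x x~y → a⋈̸y (from (a≈x y) (comparable⇒⋈ x~y)))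
      ... | yes a⋈y@(inj₁ a∈⟨y⟩) = inj₁ λ x a≈x →
        ⋈∧∉⇒⪯ (to (a≈x y) a⋈y) (λ y∈⟨x⟩ → a≉y (closedTwins-convex noncyclic a≈x a∈⟨y⟩ y∈⟨x⟩))
      ... | yes a⋈y@(inj₂ y∈⟨a⟩) = inj₂ (inj₁ λ x a≈x →
        ⋈∧∉⇒⪯ (Sum.swap (to (a≈x y) a⋈y))
          (λ x∈⟨y⟩ → a≉y (closedTwins-trans a≈x (closedTwins-convex noncyclic (closedTwins-sym a≈x) x∈⟨y⟩ y∈⟨a⟩))))

      maxHomChain⇔≐closedTwins : ∀ {U a} → U a → IsMaxHomChain G R U ⇔ U ≐ ClosedTwins a
      maxHomChain⇔≐closedTwins {U} {a} Ua = mk⇔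
        (λ (homChain , maximal) → let U⊆twins = homChain⊆closedTwins homChain Ua in
          U⊆twins , maximal (ClosedTwins a) twins-isHomChain U⊆twins)
        (λ U≐twins → isHomChain-≐ U≐twins twins-isHomChain
          , λ T homChain U⊆T → ⊆-trans (homChain⊆closedTwins homChain (U⊆T a Ua)) (proj₂ U≐twins))
        where
        twins-isHomChain : IsHomChain G R (ClosedTwins a)
        twins-isHomChain = closedTwins-isChain a , closedTwins-isHomogeneous a

proposition3p9 : (G : FiniteGroup) → ¬ IsCyclic G →
    (R : FiniteGroup.Carrier G → FiniteGroup.Carrier G → Set) → IsClassOrder G R →
    (U : Subset G) → AtLeastTwo G U →
    (IsEquivClass G U × IsClique G U) ⇔ IsMaxHomChain G R U
proposition3p9 G noncyclic R classOrder U (a , b , Ua , Ub , a≢b) =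
  ⇔-trans (mk⇔ (λ (equivClass , clique) → equivClass∧clique⇒≐closedTwins G Ua equivClass clique)
               (λ U≐twins → ≐closedTwins⇒equivClass G Ub a≢b U≐twins , ≐closedTwins⇒clique G U≐twins))
          (⇔-sym (maxHomChain⇔≐closedTwins G R classOrder noncyclic Ua))
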